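{- If $K$ is an $(H,A,B,O)$-graph on $n$ vertices and $K$ has at least $(n+1)/2$ 2-chords, then $\gamma(K)\le \lceil 2n/7\rceil$.
   Context: $\gamma(K)$ denotes the domination number of $K$ (minimum size of a set $D$ of vertices such that every vertex is in $D$ or adjacent to a vertex of $D$). Let $K$ be a (simple) graph on $n$ vertices with a Hamilton cycle $H=x_1x_2\cdots x_nx_1$; indices are taken modulo $n$. A 2-chord is an edge of the form $x_ix_{i+2}$. Define three kinds of subgraphs: an $A$ is a 3-cycle $x_ix_{i+1}x_{i+2}x_i$ (the path $x_ix_{i+1}x_{i+2}$ of $H$ plus the 2-chord $x_ix_{i+2}$) with $\deg_K(x_{i+1})=2$; a $B$ is the subgraph on four vertices consisting of the path $x_ix_{i+1}x_{i+2}x_{i+3}$ of $H$ together with the edges $x_ix_{i+2}$ and $x_{i+1}x_{i+3}$, with $\deg_K(x_{i+1})=\deg_K(x_{i+2})=3$; an $O$ is a single edge $x_ix_{i+1}$ of $H$ (with its endvertices) such that for each endvertex $x_j$ of it there is no edge $x_{j-1}x_{j+1}$. The pair $(K,H)$ is an $(H,A,B,O)$-graph if: (1) every edge of $E(K)\setminus E(H)$ is a 2-chord; (2) every edge of $K$ lies on $H$ or lies in an $A$ or a $B$; (3) $K$ is the union of $A$s, $B$s and $O$s (consecutive along $H$), any two of which intersect in at most one vertex. -}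

module Defs where

open import Data.Bool using (Bool; true; false; T)
open import Data.Nat using (ℕ; zero; suc; _+_; _*_; _∸_; _≤_; _<_; NonZero)
open import Data.Nat.DivMod using (_mod_)
open import Data.Fin using (Fin; toℕ)
open import Data.Fin.Subset using (Subset; _∈_; ∣_∣)
open import Data.List using (List; []; _∷_; length; filterᵇ; allFin; concatMap; map)
open import Data.Nat.ListAction using (sum)
open import Data.List.Relation.Unary.All using (All)
open import Data.List.Relation.Unary.Any using (Any)
open import Data.List.Relation.Unary.AllPairs using (AllPairs)
open import Data.Product using (_×_; _,_; Σ; ∃)
open import Data.Sum using (_⊎_)
open import Relation.Binary.PropositionalEquality using (_≡_)
open import Relation.Nullary using (¬_)
open import Relation.Nullary.Decidable using (⌊_⌋)
import Data.Fin as F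

-- The Hamilton cycle H is fixed to be x_0 x_1 ... x_{n-1} x_0 where
-- x_i = i mod n (every Hamiltonian graph can be so labelled).

record Graph (n : ℕ) : Set where
  field
    adj    : Fin n → Fin n → Bool
    sym    : ∀ u v → adj u v ≡ adj v u
    irrefl : ∀ u → adj u u ≡ false

open Graph public

Edge : ∀ {n} → Graph n → Fin n → Fin n → Set
Edge K u v = adj K u v ≡ true

deg : ∀ {n} → Graph n → Fin n → ℕ
deg {n} K u = length (filterᵇ (adj K u) (allFin n))

x : ∀ {n} .{{_ : NonZero n}} → ℕ → Fin n
x {n} i = i mod n

HasHamCycle : ∀ {n} .{{_ : NonZero n}} → Graph n → Set
HasHamCycle K = ∀ i → Edge K (x i) (x (suc i))

HEdge : ∀ {n} .{{_ : NonZero n}} → Fin n → Fin n → Set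
HEdge u v = (v ≡ x (suc (toℕ u))) ⊎ (u ≡ x (suc (toℕ v)))

Dominating : ∀ {n} → Graph n → Subset n → Set
Dominating {n} K D = ∀ (v : Fin n) → (v ∈ D) ⊎ (∃ λ u → (u ∈ D) × Edge K u v)

γ≤ : ∀ {n} → Graph n → ℕ → Set
γ≤ {n} K k = Σ (Subset n) λ D → Dominating K D × (∣ D ∣ ≤ k)

IsTwoChordPair : ∀ {n} .{{_ : NonZero n}} → Fin n → Fin n → Bool
IsTwoChordPair u v =
  ⌊ v F.≟ x (toℕ u + 2) ⌋ Data.Bool.∨ ⌊ u F.≟ x (toℕ v + 2) ⌋
  where import Data.Bool

orderedPairs : (n : ℕ) → List (Fin n × Fin n)
orderedPairs n = concatMap (λ u → map (λ v → (u , v)) (filterᵇ (λ v → ⌊ u F.<? v ⌋) (allFin n))) (allFin n)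

numTwoChords : ∀ {n} .{{_ : NonZero n}} → Graph n → ℕ
numTwoChords {n} K =
  length (filterᵇ (λ { (u , v) → adj K u v Data.Bool.∧ IsTwoChordPair u v }) (orderedPairs n))
  where import Data.Bool

data BlockType : Set where
  A B O : BlockType

-- number of H-edges spanned by a block
len : BlockType → ℕ
len A = 2
len B = 3
len O = 1

-- a block placed along H: (start index i , type)
Block : Set
Block = ℕ × BlockType

BlockOK : ∀ {n} .{{_ : NonZero n}} → Graph n → Block → Set
BlockOK K (i , A) = Edge K (x i) (x (i + 2)) × deg K (x (i + 1)) ≡ 2
BlockOK K (i , B) = Edge K (x i) (x (i + 2)) × Edge K (x (i + 1)) (x (i + 3))
                  × deg K (x (i + 1)) ≡ 3 × deg K (x (i + 2)) ≡ 3
BlockOK {n} K (i , O) = ¬ Edge K (x (i + n ∸ 1)) (x (i + 1))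
                      × ¬ Edge K (x i) (x (i + 2))

-- the vertices of a block starting at x_i are x_i, ..., x_{i + len}
-- two blocks share at most one vertex
AtMostOneCommon : ∀ {n} .{{_ : NonZero n}} → Block → Block → Set
AtMostOneCommon {n} (i , s) (j , t) =
  ∀ a a' b b' → a ≤ len s → a' ≤ len s → b ≤ len t → b' ≤ len t →
  x {n} (i + a) ≡ x (j + b) → x {n} (i + a') ≡ x (j + b') → x {n} (i + a) ≡ x (i + a')

SamePair : ∀ {n} → Fin n → Fin n → Fin n → Fin n → Set
SamePair u v a b = ((u ≡ a) × (v ≡ b)) ⊎ ((u ≡ b) × (v ≡ a))

ChordOf : ∀ {n} .{{_ : NonZero n}} → Fin n → Fin n → Block → Set
ChordOf u v (i , A) = SamePair u v (x i) (x (i + 2))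
ChordOf u v (i , B) = SamePair u v (x i) (x (i + 2)) ⊎ SamePair u v (x (i + 1)) (x (i + 3))
ChordOf u v (i , O) = Data.Empty.⊥
  where import Data.Empty

place : ℕ → List BlockType → List Block
place s []      = []
place s (t ∷ ts) = (s , t) ∷ place (s + len t) ts

-- (H,A,B,O)-graphs: K (with Hamilton cycle x_0 ... x_{n-1}) is the union
-- of consecutive blocks A, B, O going once around H, any two of which
-- meet in at most one vertex; every edge of K is an edge of H or a
-- 2-chord of one of the A's / B's (this gives conditions (1), (2) and the
-- edge part of "K is the union").

record IsHABO {n : ℕ} .{{_ : NonZero n}} (K : Graph n) : Set where
  field
    hamilton : HasHamCycle K
    offset   : ℕ
    blocks   : List BlockType
    covers   : sum (map len blocks) ≡ n
    blocksOK : All (BlockOK K) (place offset blocks)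
    disjoint : AllPairs AtMostOneCommon (place offset blocks)
    edges    : ∀ u v → Edge K u v → HEdge u v ⊎ Any (ChordOf u v) (place offset blocks)

module Submission where

-- Give the blocks A, B, O the weights 4, 5, 3, that is 3·len − 2·(number of
-- 2-chords of the block).  The proof has two independent halves.
--
-- Walking once around H block by block, a three-state
--   automaton (the frontier is free, covered or waiting) chooses vertices so
--   that every vertex ends up dominated; an amortised potential shows that
--   seven times the number of chosen vertices is at most the total weight
--   plus 5.  For n ≥ 4 no edge of H is a 2-chord, so every 2-chord
--   of K is a chord of some block and K has at most #A + 2·#B two-chords.
--   As weight + 2·chords = 3n, the hypothesis forces weight ≤ 2n − 1.
--
-- Hence 7·|D| ≤ 2n + 4 for the greedy set D.  The triangle (n = 3) is
-- dominated by one vertex.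
--
-- Positions on H are natural numbers read modulo n (x i = i mod n).

open import Defs hiding (sym)
open import Data.Nat using (ℕ; zero; suc; _+_; _*_; _∸_; _≤_; _<_; _/_; _%_; NonZero; pred; z≤n; s≤s; s≤s⁻¹)
open import Data.Nat.Properties
open import Data.Nat.DivMod using (m≡m%n+[m/n]*n; %-distribˡ-+; m%n%n≡m%n; [m+n]%n≡m%n; m<n⇒m%n≡m; m*n/n≡m; /-monoˡ-≤)
open import Data.Nat.Divisibility using (_∣_; divides; ∣⇒≤)
open import Data.Nat.ListAction using (sum)
open import Data.Nat.Solver using (module +-*-Solver)
open import Data.Bool using (Bool; T; T?)
open import Data.Bool.Properties using (T-∧; T-∨; T-≡)
open import Data.Fin using (Fin; toℕ)
import Data.Fin as F
open import Data.Fin.Properties using (toℕ-fromℕ<; toℕ-injective; toℕ<n) renaming (<-asym to <-asymᶠ)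
open import Data.Fin.Subset using (Subset; _∈_; ∣_∣; ⁅_⁆; _∪_; inside; outside) renaming (⊥ to ∅)
open import Data.Fin.Subset.Properties using (∣⊥∣≡0; ∣⁅x⁆∣≡1; x∈⁅x⁆; x∈p∪q⁺; q⊆p∪q)
open import Data.Vec using (_∷_; [])
open import Data.List using (List; []; _∷_; _++_; length; map; filterᵇ; allFin; concatMap)
open import Data.List.Properties using (length-++; length-removeAt′)
open import Data.List.Relation.Unary.All as All using (All; []; _∷_)
open import Data.List.Relation.Unary.All.Properties using (++⁻ˡ; ++⁻ʳ)
open import Data.List.Relation.Unary.Any as Any using (here; there; satisfied; _─_)
open import Data.List.Relation.Unary.AllPairs as AllPairs using (_∷_)
import Data.List.Relation.Unary.AllPairs.Properties as AllPairsₚ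
open import Data.List.Relation.Unary.Unique.Propositional using (Unique)
import Data.List.Relation.Unary.Unique.Propositional.Properties as Unique
open import Data.List.Membership.Propositional using () renaming (_∈_ to _∈ₗ_)
open import Data.List.Membership.Propositional.Properties using (∈-map⁻; ∈-filter⁻; ∈-concatMap⁺; ∈-concatMap⁻)
open import Data.Product using (_×_; _,_; Σ; ∃; proj₁; proj₂)
open import Data.Sum using (_⊎_; inj₁; inj₂)
open import Data.Unit using (⊤; tt)
open import Data.Empty using (⊥; ⊥-elim)
open import Function using (_∘_)
open import Function.Bundles using (Equivalence)
open import Relation.Binary.PropositionalEquality using (_≡_; _≢_; refl; sym; trans; cong; cong₂; subst; subst₂; module ≡-Reasoning)
open import Relation.Nullary using (yes; no)
open import Relation.Nullary.Decidable using (⌊_⌋; toWitness)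

-- Positions on the Hamilton cycle

module _ {n : ℕ} .{{_ : NonZero n}} where
  open ≡-Reasoning

  toℕ-x : ∀ i → toℕ (x {n} i) ≡ i % n
  toℕ-x i = toℕ-fromℕ< _

  x-cong : ∀ {i j} → i % n ≡ j % n → x {n} i ≡ x j
  x-cong {i} {j} e = toℕ-injective (trans (toℕ-x i) (trans e (sym (toℕ-x j))))

  x-residue : ∀ {i j} → x {n} i ≡ x j → i % n ≡ j % n
  x-residue {i} {j} e = trans (sym (toℕ-x i)) (trans (cong toℕ e) (toℕ-x j))

  x-toℕ : ∀ (v : Fin n) → x (toℕ v) ≡ v
  x-toℕ v = toℕ-injective (trans (toℕ-x (toℕ v)) (m<n⇒m%n≡m (toℕ<n v)))

  x-shift : ∀ i k → x {n} (toℕ (x {n} i) + k) ≡ x (i + k)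
  x-shift i k = x-cong (begin
    (toℕ (x i) + k) % n      ≡⟨ cong (λ r → (r + k) % n) (toℕ-x i) ⟩
    (i % n + k) % n          ≡⟨ %-distribˡ-+ (i % n) k n ⟩
    (i % n % n + k % n) % n  ≡⟨ cong (λ r → (r + k % n) % n) (m%n%n≡m%n i n) ⟩
    (i % n + k % n) % n      ≡⟨ sym (%-distribˡ-+ i k n) ⟩
    (i + k) % n              ∎)

  x-period : ∀ i k → x {n} i ≡ x (i + k) → n ∣ k
  x-period i k e = divides (q₁ ∸ q₀) (begin
    k                                         ≡⟨ sym (m+n∸m≡n i k) ⟩
    (i + k) ∸ i                               ≡⟨ cong₂ _∸_ (m≡m%n+[m/n]*n (i + k) n) (m≡m%n+[m/n]*n i n) ⟩
    ((i + k) % n + q₁ * n) ∸ (i % n + q₀ * n) ≡⟨ cong (λ r → (r + q₁ * n) ∸ (i % n + q₀ * n)) (sym (x-residue e)) ⟩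
    (i % n + q₁ * n) ∸ (i % n + q₀ * n)       ≡⟨ [m+n]∸[m+o]≡n∸o (i % n) (q₁ * n) (q₀ * n) ⟩
    q₁ * n ∸ q₀ * n                           ≡⟨ sym (*-distribʳ-∸ n q₁ q₀) ⟩
    (q₁ ∸ q₀) * n                             ∎)
    where
    q₀ = i / n
    q₁ = (i + k) / n

  x-distinct : ∀ i k → suc k < n → x {n} i ≢ x (i + suc k)
  x-distinct i k k<n e = <⇒≱ k<n (∣⇒≤ (x-period i (suc k) e))

  window : ∀ s (v : Fin n) → ∃ λ d → d < n × x (s + d) ≡ v
  window zero v = toℕ v , toℕ<n v , x-toℕ v
  window (suc s) v with window s v
  ... | suc d , d<n , e = d , <-trans (n<1+n d) d<n , trans (cong x (sym (+-suc s d))) e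
  ... | zero  , _   , e = pred n , ≤-reflexive (suc-pred n) , (begin
    x (suc s + pred n)    ≡⟨ cong x (sym (+-suc s (pred n))) ⟩
    x (s + suc (pred n))  ≡⟨ cong (λ m → x (s + m)) (suc-pred n) ⟩
    x (s + n)             ≡⟨ x-cong ([m+n]%n≡m%n s n) ⟩
    x s                   ≡⟨ cong x (sym (+-identityʳ s)) ⟩
    x (s + 0)             ≡⟨ e ⟩
    v                     ∎)

∣p∪q∣≤∣p∣+∣q∣ : ∀ {m} (p q : Subset m) → ∣ p ∪ q ∣ ≤ ∣ p ∣ + ∣ q ∣
∣p∪q∣≤∣p∣+∣q∣ []            []            = z≤n
∣p∪q∣≤∣p∣+∣q∣ (outside ∷ p) (outside ∷ q) = ∣p∪q∣≤∣p∣+∣q∣ p q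
∣p∪q∣≤∣p∣+∣q∣ (outside ∷ p) (inside  ∷ q) =
  ≤-trans (s≤s (∣p∪q∣≤∣p∣+∣q∣ p q)) (≤-reflexive (sym (+-suc ∣ p ∣ ∣ q ∣)))
∣p∪q∣≤∣p∣+∣q∣ (inside  ∷ p) (outside ∷ q) = s≤s (∣p∪q∣≤∣p∣+∣q∣ p q)
∣p∪q∣≤∣p∣+∣q∣ (inside  ∷ p) (inside  ∷ q) =
  s≤s (≤-trans (∣p∪q∣≤∣p∣+∣q∣ p q) (+-monoʳ-≤ ∣ p ∣ (n≤1+n ∣ q ∣)))

module _ {n : ℕ} .{{_ : NonZero n}} where

  atPositions : List ℕ → Subset n
  atPositions []       = ∅
  atPositions (j ∷ js) = ⁅ x j ⁆ ∪ atPositions js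

  atPositions-size : ∀ js → ∣ atPositions js ∣ ≤ length js
  atPositions-size []       = ≤-reflexive (∣⊥∣≡0 n)
  atPositions-size (j ∷ js) = begin
    ∣ ⁅ x j ⁆ ∪ atPositions js ∣      ≤⟨ ∣p∪q∣≤∣p∣+∣q∣ ⁅ x j ⁆ (atPositions js) ⟩
    ∣ ⁅ x j ⁆ ∣ + ∣ atPositions js ∣  ≡⟨ cong (_+ ∣ atPositions js ∣) (∣⁅x⁆∣≡1 (x j)) ⟩
    suc ∣ atPositions js ∣            ≤⟨ s≤s (atPositions-size js) ⟩
    suc (length js)                   ∎
    where open ≤-Reasoning

  atPositions-∈ : ∀ js → All (λ j → x j ∈ atPositions js) js
  atPositions-∈ []       = []
  atPositions-∈ (j ∷ js) =
    x∈p∪q⁺ (inj₁ (x∈⁅x⁆ (x j))) ∷ All.map (q⊆p∪q ⁅ x j ⁆ (atPositions js)) (atPositions-∈ js)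

chordCount : BlockType → ℕ
chordCount A = 1
chordCount B = 2
chordCount O = 0

-- the weight 3·len − 2·chordCount, which bounds 7 × (vertices chosen per block)
weight : BlockType → ℕ
weight A = 4
weight B = 5
weight O = 3

total : (BlockType → ℕ) → List BlockType → ℕ
total f bs = sum (map f bs)

total-weight-chords : ∀ bs → total weight bs + 2 * total chordCount bs ≡ 3 * total len bs
total-weight-chords []       = refl
total-weight-chords (t ∷ ts) = begin
  (weight t + W) + 2 * (chordCount t + C)  ≡⟨ rearrange (weight t) W (chordCount t) C ⟩
  (weight t + 2 * chordCount t) + (W + 2 * C) ≡⟨ cong₂ _+_ (per-block t) (total-weight-chords ts) ⟩
  3 * len t + 3 * total len ts               ≡⟨ sym (*-distribˡ-+ 3 (len t) (total len ts)) ⟩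
  3 * (len t + total len ts)                 ∎
  where
  open ≡-Reasoning
  open +-*-Solver
  W = total weight ts
  C = total chordCount ts
  per-block : ∀ t → weight t + 2 * chordCount t ≡ 3 * len t
  per-block A = refl
  per-block B = refl
  per-block O = refl
  rearrange : ∀ w v c d → (w + v) + 2 * (c + d) ≡ (w + 2 * c) + (v + 2 * d)
  rearrange = solve 4 (λ w v c d → (w :+ v) :+ con 2 :* (c :+ d) := (w :+ con 2 :* c) :+ (v :+ con 2 :* d)) refl

-- The greedy walk around H

-- The frontier at the first vertex x_P of the next block: everything before
-- x_P is dominated (free), also x_P is (covered), or choosing x_P would
-- dominate everything up to and including x_P (waiting).
data Frontier : Set where
  free covered waiting : Frontier

next : Frontier → BlockType → Frontier
next free    A = waiting
next free    B = covered
next free    O = waiting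
next covered A = waiting
next covered B = waiting
next covered O = free
next waiting A = covered
next waiting B = free
next waiting O = covered

picks : Frontier → BlockType → ℕ → List ℕ
picks free    B P = suc P ∷ []
picks waiting _ P = P ∷ []
picks _       _ _ = []

potential : Frontier → ℕ
potential free    = 2
potential covered = 0
potential waiting = 4

step-cost : ∀ st t P → 7 * length (picks st t P) + potential (next st t) ≤ weight t + potential st
step-cost free    A P = ≤ᵇ⇒≤ 4 6 _
step-cost free    B P = ≤ᵇ⇒≤ 7 7 _
step-cost free    O P = ≤ᵇ⇒≤ 4 5 _
step-cost covered A P = ≤ᵇ⇒≤ 4 4 _
step-cost covered B P = ≤ᵇ⇒≤ 4 5 _
step-cost covered O P = ≤ᵇ⇒≤ 2 3 _
step-cost waiting A P = ≤ᵇ⇒≤ 7 8 _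
step-cost waiting B P = ≤ᵇ⇒≤ 9 9 _
step-cost waiting O P = ≤ᵇ⇒≤ 7 7 _

choices : Frontier → ℕ → List BlockType → List ℕ
choices st P []       = []
choices st P (t ∷ ts) = picks st t P ++ choices (next st t) (P + len t) ts

finalFrontier : Frontier → List BlockType → Frontier
finalFrontier st []       = st
finalFrontier st (t ∷ ts) = finalFrontier (next st t) ts

closing : Frontier → ℕ → List ℕ
closing waiting E = E ∷ []
closing _       _ = []

choices-cost : ∀ st P ts →
  7 * length (choices st P ts) + potential (finalFrontier st ts) ≤ total weight ts + potential st
choices-cost st P []       = ≤-refl
choices-cost st P (t ∷ ts) = begin
  7 * length (now ++ rest) + φ              ≡⟨ cong (λ m → 7 * m + φ) (length-++ now) ⟩
  7 * (length now + length rest) + φ        ≡⟨ split (length now) (length rest) φ ⟩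
  7 * length now + (7 * length rest + φ)    ≤⟨ +-monoʳ-≤ (7 * length now) (choices-cost (next st t) (P + len t) ts) ⟩
  7 * length now + (W + potential (next st t)) ≡⟨ swap (7 * length now) W (potential (next st t)) ⟩
  (7 * length now + potential (next st t)) + W ≤⟨ +-monoˡ-≤ W (step-cost st t P) ⟩
  (weight t + potential st) + W              ≡⟨ swap′ (weight t) (potential st) W ⟩
  (weight t + W) + potential st              ∎
  where
  open ≤-Reasoning
  open +-*-Solver
  now = picks st t P
  rest = choices (next st t) (P + len t) ts
  φ = potential (finalFrontier (next st t) ts)
  W = total weight ts
  split : ∀ a b c → 7 * (a + b) + c ≡ 7 * a + (7 * b + c)
  split = solve 3 (λ a b c → con 7 :* (a :+ b) :+ c := con 7 :* a :+ (con 7 :* b :+ c)) refl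
  swap : ∀ a b c → a + (b + c) ≡ (a + c) + b
  swap = solve 3 (λ a b c → a :+ (b :+ c) := (a :+ c) :+ b) refl
  swap′ : ∀ a b c → (a + b) + c ≡ (a + c) + b
  swap′ = solve 3 (λ a b c → (a :+ b) :+ c := (a :+ c) :+ b) refl

closing-cost : ∀ st E → 7 * length (closing st E) + 2 ≤ potential st + 5
closing-cost free    E = ≤ᵇ⇒≤ 2 7 _
closing-cost covered E = ≤ᵇ⇒≤ 2 5 _
closing-cost waiting E = ≤ᵇ⇒≤ 9 9 _

walk-cost : ∀ s bs E →
  7 * length (choices free s bs ++ closing (finalFrontier free bs) E) ≤ total weight bs + 5
walk-cost s bs E = +-cancelʳ-≤ 2 _ _ (begin
  7 * length (cs ++ cl) + 2          ≡⟨ cong (λ m → 7 * m + 2) (length-++ cs) ⟩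
  7 * (length cs + length cl) + 2    ≡⟨ split (length cs) (length cl) ⟩
  7 * length cs + (7 * length cl + 2) ≤⟨ +-monoʳ-≤ (7 * length cs) (closing-cost st E) ⟩
  7 * length cs + (φ + 5)            ≡⟨ sym (+-assoc (7 * length cs) φ 5) ⟩
  (7 * length cs + φ) + 5            ≤⟨ +-monoˡ-≤ 5 (choices-cost free s bs) ⟩
  (total weight bs + 2) + 5          ≡⟨ swap (total weight bs) ⟩
  (total weight bs + 5) + 2          ∎)
  where
  open ≤-Reasoning
  open +-*-Solver
  st = finalFrontier free bs
  cs = choices free s bs
  cl = closing st E
  φ = potential st
  split : ∀ a b → 7 * (a + b) + 2 ≡ 7 * a + (7 * b + 2)
  split = solve 2 (λ a b → con 7 :* (a :+ b) :+ con 2 := con 7 :* a :+ (con 7 :* b :+ con 2)) refl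
  swap : ∀ w → (w + 2) + 5 ≡ (w + 5) + 2
  swap = solve 1 (λ w → (w :+ con 2) :+ con 5 := (w :+ con 5) :+ con 2) refl

module Walk {n : ℕ} .{{_ : NonZero n}} (K : Graph n) (ham : HasHamCycle K) (D : Subset n) (s : ℕ) where

  DominatedVertex : Fin n → Set
  DominatedVertex v = (v ∈ D) ⊎ ∃ λ u → (u ∈ D) × Edge K u v

  Dominated : ℕ → Set
  Dominated j = DominatedVertex (x j)

  DominatedBelow : ℕ → Set
  DominatedBelow P = ∀ j → s ≤ j → j < P → Dominated j

  Chosen : List ℕ → Set
  Chosen = All (λ j → x j ∈ D)

  flip : ∀ {u v} → Edge K u v → Edge K v u
  flip {u} {v} e = trans (Graph.sym K v u) e

  backward : ∀ i → Edge K (x (suc i)) (x i)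
  backward i = flip (ham i)

  self : ∀ {j} → x j ∈ D → Dominated j
  self = inj₁

  nbr : ∀ {i j} → x i ∈ D → Edge K (x i) (x j) → Dominated j
  nbr {i} p e = inj₂ (x i , p , e)

  nothing-below : DominatedBelow s
  nothing-below j s≤j j<s = ⊥-elim (<-irrefl refl (≤-<-trans s≤j j<s))

  extend : ∀ {P} → DominatedBelow P → Dominated P → DominatedBelow (suc P)
  extend below at j s≤j j<1+P with m≤n⇒m<n∨m≡n (s≤s⁻¹ j<1+P)
  ... | inj₁ j<P  = below j s≤j j<P
  ... | inj₂ refl = at

  shrink : ∀ {P} → DominatedBelow (suc P) → DominatedBelow P
  shrink below j s≤j j<P = below j s≤j (m<n⇒m<1+n j<P)

  pending : ∀ {P} → DominatedBelow P → x (suc P) ∈ D → DominatedBelow (2 + P)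
  pending {P} below p = extend (extend below (nbr p (backward P))) (self p)

  Invariant : Frontier → ℕ → Set
  Invariant free    P = DominatedBelow P
  Invariant covered P = DominatedBelow (suc P)
  Invariant waiting P = x P ∈ D → DominatedBelow (suc P)

  resolve : ∀ {P} → Invariant waiting P → x P ∈ D → DominatedBelow (2 + P)
  resolve {P} inv p = extend (inv p) (nbr p (ham P))

  Chords : BlockType → ℕ → Set
  Chords A P = Edge K (x P) (x (2 + P))
  Chords B P = Edge K (x P) (x (2 + P)) × Edge K (x (1 + P)) (x (3 + P))
  Chords O P = ⊤

  chords : ∀ t P → BlockOK K (P , t) → Chords t P
  chords A P (c , _)          = subst (λ m → Edge K (x P) (x m)) (+-comm P 2) c
  chords B P (c , c′ , _ , _) = subst (λ m → Edge K (x P) (x m)) (+-comm P 2) c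
                              , subst₂ (λ a b → Edge K (x a) (x b)) (+-comm P 1) (+-comm P 3) c′
  chords O P _                = tt

  step : ∀ st t P → Invariant st P → Chords t P → Chosen (picks st t P) → Invariant (next st t) (len t + P)
  step free    A P inv c       _          = λ p → pending (extend inv (nbr p (flip c))) p
  step free    B P inv (_ , c) (p ∷ [])   = extend (extend (pending inv p) (nbr p (ham (suc P)))) (nbr p c)
  step free    O P inv _       _          = pending inv
  step covered A P inv _       _          = pending inv
  step covered B P inv (_ , c) _          = λ p → pending (extend inv (nbr p (flip c))) p
  step covered O P inv _       _          = inv
  step waiting A P inv c       (p ∷ [])   = extend (resolve inv p) (nbr p c)
  step waiting B P inv (c , _) (p ∷ [])   = extend (resolve inv p) (nbr p c)
  step waiting O P inv _       (p ∷ [])   = resolve inv p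

  walk : ∀ st P ts → Invariant st P → All (BlockOK K) (place P ts) → Chosen (choices st P ts) →
         Invariant (finalFrontier st ts) (P + total len ts)
  walk st P []       inv _          _  = subst (Invariant st) (sym (+-identityʳ P)) inv
  walk st P (t ∷ ts) inv (ok ∷ oks) ch =
    subst (Invariant (finalFrontier (next st t) ts)) (+-assoc P (len t) (total len ts))
      (walk (next st t) (P + len t) ts inv′ oks (++⁻ʳ (picks st t P) ch))
    where
    inv′ : Invariant (next st t) (P + len t)
    inv′ = subst (Invariant (next st t)) (+-comm (len t) P)
             (step st t P inv (chords t P ok) (++⁻ˡ (picks st t P) ch))

  close : ∀ st E → Invariant st E → Chosen (closing st E) → DominatedBelow E
  close free    E inv _        = inv
  close covered E inv _        = shrink inv
  close waiting E inv (p ∷ []) = shrink (inv p)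

  dominating : DominatedBelow (s + n) → Dominating K D
  dominating below v with window s v
  ... | d , d<n , refl = below (s + d) (m≤m+n s d) (+-monoʳ-< s d<n)

greedy-domination : ∀ {n} .{{_ : NonZero n}} (K : Graph n) → HasHamCycle K → ∀ s bs →
  total len bs ≡ n → All (BlockOK K) (place s bs) →
  Σ (Subset n) λ D → Dominating K D × 7 * ∣ D ∣ ≤ total weight bs + 5
greedy-domination {n} K ham s bs covers ok = D , dominates , size
  where
  js = choices free s bs ++ closing (finalFrontier free bs) (s + n)
  D = atPositions js
  open Walk K ham D s
  chosen : Chosen js
  chosen = atPositions-∈ js
  walked : Invariant (finalFrontier free bs) (s + n)
  walked = subst (Invariant _) (cong (s +_) covers)
             (walk free s bs nothing-below ok (++⁻ˡ (choices free s bs) chosen))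
  dominates : Dominating K D
  dominates = dominating (close _ (s + n) walked (++⁻ʳ (choices free s bs) chosen))
  size : 7 * ∣ D ∣ ≤ total weight bs + 5
  size = ≤-trans (*-monoʳ-≤ 7 (atPositions-size js)) (walk-cost s bs (s + n))

-- Counting 2-chords

module _ {a} {X : Set a} where

  ∈-─ : ∀ {z w} {ys : List X} (p : z ∈ₗ ys) → w ∈ₗ ys → w ≢ z → w ∈ₗ (ys ─ p)
  ∈-─ (here refl) (here refl) w≢z = ⊥-elim (w≢z refl)
  ∈-─ (here _)    (there q)   _   = q
  ∈-─ (there p)   (here refl) _   = here refl
  ∈-─ (there p)   (there q)   w≢z = there (∈-─ p q w≢z)

  unique-length : ∀ {xs ys : List X} → Unique xs → (∀ {z} → z ∈ₗ xs → z ∈ₗ ys) → length xs ≤ length ys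
  unique-length {[]}     _           _   = z≤n
  unique-length {z ∷ zs} {ys} (z∉zs ∷ u) sub = begin
    suc (length zs)           ≤⟨ s≤s (unique-length u sub′) ⟩
    suc (length (ys ─ z∈ys))  ≡⟨ sym (length-removeAt′ ys (Any.index z∈ys)) ⟩
    length ys                 ∎
    where
    open ≤-Reasoning
    z∈ys = sub (here refl)
    sub′ : ∀ {w} → w ∈ₗ zs → w ∈ₗ (ys ─ z∈ys)
    sub′ w∈zs = ∈-─ z∈ys (sub (there w∈zs)) (λ w≡z → All.lookup z∉zs w∈zs (sym w≡z))

module _ (n : ℕ) where

  pairsFrom : Fin n → List (Fin n × Fin n)
  pairsFrom u = map (u ,_) (filterᵇ (λ v → ⌊ u F.<? v ⌋) (allFin n))

  pairsFrom-first : ∀ {u p} → p ∈ₗ pairsFrom u → proj₁ p ≡ u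
  pairsFrom-first p∈ with _ , _ , refl ← ∈-map⁻ _ p∈ = refl

  orderedPairs-unique : Unique (orderedPairs n)
  orderedPairs-unique = Unique.concat⁺
    (All.tabulate (λ {ps} ps∈ → unique-group ps∈))
    (AllPairsₚ.map⁺ (AllPairs.map (λ u≢w {_} (p∈u , p∈w) → u≢w (trans (sym (pairsFrom-first p∈u)) (pairsFrom-first p∈w)))
                                 (Unique.allFin⁺ n)))
    where
    unique-group : ∀ {ps} → ps ∈ₗ map pairsFrom (allFin n) → Unique ps
    unique-group ps∈ with _ , _ , refl ← ∈-map⁻ _ ps∈ =
      Unique.map⁺ (λ { refl → refl }) (Unique.filter⁺ _ (Unique.allFin⁺ n))

  orderedPairs-< : ∀ {u v} → (u , v) ∈ₗ orderedPairs n → u F.< v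
  orderedPairs-< p∈ with w , q ← satisfied (∈-concatMap⁻ pairsFrom {xs = allFin n} p∈)
                    with v′ , v′∈ , refl ← ∈-map⁻ _ q =
    toWitness (proj₂ (∈-filter⁻ (λ v → T? ⌊ w F.<? v ⌋) {xs = allFin n} v′∈))

module _ {n : ℕ} .{{_ : NonZero n}} where

  sortPair : Fin n → Fin n → Fin n × Fin n
  sortPair p q with p F.<? q
  ... | yes _ = p , q
  ... | no _  = q , p

  sortPair-same : ∀ {u v p q} → u F.< v → SamePair u v p q → (u , v) ≡ sortPair p q
  sortPair-same {u} {v} u<v (inj₁ (refl , refl)) with u F.<? v
  ... | yes _   = refl
  ... | no  u≮v = ⊥-elim (u≮v u<v)
  sortPair-same {u} {v} u<v (inj₂ (refl , refl)) with v F.<? u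
  ... | yes v<u = ⊥-elim (<-asymᶠ u<v v<u)
  ... | no  _   = refl

  blockChords : Block → List (Fin n × Fin n)
  blockChords (i , A) = sortPair (x i) (x (i + 2)) ∷ []
  blockChords (i , B) = sortPair (x i) (x (i + 2)) ∷ sortPair (x (i + 1)) (x (i + 3)) ∷ []
  blockChords (i , O) = []

  blockChords-complete : ∀ {u v b} → u F.< v → ChordOf u v b → (u , v) ∈ₗ blockChords b
  blockChords-complete {b = i , A} u<v same        = here (sortPair-same u<v same)
  blockChords-complete {b = i , B} u<v (inj₁ same) = here (sortPair-same u<v same)
  blockChords-complete {b = i , B} u<v (inj₂ same) = there (here (sortPair-same u<v same))

  placedChords-length : ∀ s bs → length (concatMap blockChords (place s bs)) ≡ total chordCount bs
  placedChords-length s []       = refl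
  placedChords-length s (t ∷ ts) = trans (length-++ (blockChords (s , t)))
                                         (cong₂ _+_ (per-block t) (placedChords-length (s + len t) ts))
    where
    per-block : ∀ t → length (blockChords (s , t)) ≡ chordCount t
    per-block A = refl
    per-block B = refl
    per-block O = refl

  twoChord-pair : ∀ {u v} → T (IsTwoChordPair u v) → v ≡ x (toℕ u + 2) ⊎ u ≡ x (toℕ v + 2)
  twoChord-pair {u} {v} t with Equivalence.to (T-∨ {⌊ v F.≟ x (toℕ u + 2) ⌋} {⌊ u F.≟ x (toℕ v + 2) ⌋}) t
  ... | inj₁ t₁ = inj₁ (toWitness {a? = v F.≟ x (toℕ u + 2)} t₁)
  ... | inj₂ t₂ = inj₂ (toWitness {a? = u F.≟ x (toℕ v + 2)} t₂)

  -- for n ≥ 4: x_{a+1} ≠ x_{a+2}, and x_a ≠ x_{a+3} (reached as two steps after x_{a+1})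
  one≢two : 4 ≤ n → ∀ a → x {n} (suc a) ≢ x (a + 2)
  one≢two 4≤n a e = x-distinct (suc a) 0 (≤-trans (s≤s (s≤s z≤n)) 4≤n) (trans e (cong x (+-suc a 1)))

  zero≢three : 4 ≤ n → ∀ a → x {n} a ≢ x (toℕ (x {n} (suc a)) + 2)
  zero≢three 4≤n a e = x-distinct a 2 4≤n (trans e (trans (x-shift (suc a) 2) (cong x (sym (+-suc a 2)))))

  HEdge-not-twoChord : 4 ≤ n → ∀ {u v} → HEdge u v → T (IsTwoChordPair u v) → ⊥
  HEdge-not-twoChord 4≤n {u} {v} h t with h | twoChord-pair {u} {v} t
  ... | inj₁ e₁ | inj₁ e₂ = one≢two 4≤n (toℕ u) (trans (sym e₁) e₂)
  ... | inj₁ e₁ | inj₂ e₂ = zero≢three 4≤n (toℕ u) (trans (x-toℕ u) (trans e₂ (cong (λ w → x (toℕ w + 2)) e₁)))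
  ... | inj₂ e₁ | inj₁ e₂ = zero≢three 4≤n (toℕ v) (trans (x-toℕ v) (trans e₂ (cong (λ w → x (toℕ w + 2)) e₁)))
  ... | inj₂ e₁ | inj₂ e₂ = one≢two 4≤n (toℕ v) (trans (sym e₁) e₂)

  -- each 2-chord selected from orderedPairs is a chord of some block, so
  -- there are at most as many of them as the blocks carry
  selected-chords-bound : 4 ≤ n → (K : Graph n) (h : IsHABO K) (f : Fin n × Fin n → Bool) →
    (∀ {u v} → T (f (u , v)) → Edge K u v × T (IsTwoChordPair u v)) →
    length (filterᵇ f (orderedPairs n)) ≤ total chordCount (IsHABO.blocks h)
  selected-chords-bound 4≤n K h f selected = begin
    length (filterᵇ f (orderedPairs n)) ≤⟨ unique-length (Unique.filter⁺ (T? ∘ f) (orderedPairs-unique n)) listed ⟩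
    length chordList                    ≡⟨ placedChords-length offset blocks ⟩
    total chordCount blocks             ∎
    where
    open ≤-Reasoning
    open IsHABO h
    chordList = concatMap blockChords (place offset blocks)
    listed : ∀ {p} → p ∈ₗ filterᵇ f (orderedPairs n) → p ∈ₗ chordList
    listed {u , v} p∈ with ∈-filter⁻ (T? ∘ f) {xs = orderedPairs n} p∈
    ... | p∈pairs , fp with selected fp
    ... | e , chord with edges u v e
    ... | inj₁ hedge   = ⊥-elim (HEdge-not-twoChord 4≤n hedge chord)
    ... | inj₂ inBlock = ∈-concatMap⁺ blockChords (Any.map (blockChords-complete (orderedPairs-< n p∈pairs)) inBlock)

  twoChords-bound : 4 ≤ n → (K : Graph n) (h : IsHABO K) → numTwoChords K ≤ total chordCount (IsHABO.blocks h)
  twoChords-bound 4≤n K h = selected-chords-bound 4≤n K h _ (λ t →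
    let (e , c) = Equivalence.to T-∧ t in Equivalence.to T-≡ e , c)

light-weight : ∀ w c n → w + c ≡ 3 * n → n + 1 ≤ c → w + 1 ≤ 2 * n
light-weight w c n eq n<c = +-cancelʳ-≤ n (w + 1) (2 * n) (begin
  w + 1 + n    ≡⟨ +-assoc w 1 n ⟩
  w + (1 + n)  ≡⟨ cong (w +_) (+-comm 1 n) ⟩
  w + (n + 1)  ≤⟨ +-monoʳ-≤ w n<c ⟩
  w + c        ≡⟨ eq ⟩
  3 * n        ≡⟨ solve 1 (λ n → con 3 :* n := con 2 :* n :+ n) refl n ⟩
  2 * n + n    ∎)
  where
  open ≤-Reasoning
  open +-*-Solver

k*d≤m⇒d≤m/k : ∀ k {d m} .{{_ : NonZero k}} → k * d ≤ m → d ≤ m / k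
k*d≤m⇒d≤m/k k {d} {m} kd≤m = subst (_≤ m / k) (m*n/n≡m d k) (/-monoˡ-≤ k (subst (_≤ m) (*-comm k d) kd≤m))

-- on three vertices x_0 is adjacent to both other vertices along H
triangle : (K : Graph 3) → HasHamCycle K → γ≤ K 1
triangle K ham = ⁅ F.zero ⁆ , dominates , ≤-reflexive (∣⁅x⁆∣≡1 {n = 2} F.zero)
  where
  dominates : Dominating K ⁅ F.zero ⁆
  dominates F.zero                   = inj₁ (x∈⁅x⁆ F.zero)
  dominates (F.suc F.zero)           = inj₂ (F.zero , x∈⁅x⁆ F.zero , ham 0)
  dominates (F.suc (F.suc F.zero))   = inj₂ (F.zero , x∈⁅x⁆ F.zero , trans (Graph.sym K _ _) (ham 2))

theorem3p1 : (n : ℕ) .{{_ : NonZero n}} → 3 ≤ n → (K : Graph n) → IsHABO K →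
    n + 1 ≤ 2 * numTwoChords K →
    γ≤ K ((2 * n + 6) / 7)
theorem3p1 n 3≤n K h many-chords with m≤n⇒m<n∨m≡n 3≤n
... | inj₂ refl = triangle K (IsHABO.hamilton h)
... | inj₁ 4≤n  = D , dominates , k*d≤m⇒d≤m/k 7 (begin
  7 * ∣ D ∣                  ≤⟨ small ⟩
  total weight blocks + 5    ≡⟨ sym (+-assoc (total weight blocks) 1 4) ⟩
  total weight blocks + 1 + 4 ≤⟨ +-monoˡ-≤ 4 light ⟩
  2 * n + 4                  ≤⟨ +-monoʳ-≤ (2 * n) (≤ᵇ⇒≤ 4 6 _) ⟩
  2 * n + 6                  ∎)
  where
  open ≤-Reasoning
  open IsHABO h
  greedy = greedy-domination K hamilton offset blocks covers blocksOK
  D = proj₁ greedy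
  dominates = proj₁ (proj₂ greedy)
  small = proj₂ (proj₂ greedy)
  light : total weight blocks + 1 ≤ 2 * n
  light = light-weight (total weight blocks) (2 * total chordCount blocks) n
            (trans (total-weight-chords blocks) (cong (3 *_) covers))
            (≤-trans many-chords (*-monoʳ-≤ 2 (twoChords-bound 4≤n K h)))
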